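{- Let $(X,\mathcal{R})$ be a $d$-class $Q$-polynomial association scheme, $C$ a subset of $X$ with dual inner distribution $(b_0,\ldots,b_d)$ and characteristic matrices $H_0,\ldots,H_d$. Then for all $i,j\in\{0,1,\ldots,d\}$, $$\|H_i^TH_j\|^2=|C|\sum_{k=|i-j|}^{\min\{d,i+j\}}q_{i,j}^k b_k ,$$ where $\|\cdot\|$ is the Frobenius (Hermitian) norm.
   Context: $(X,\mathcal{R})$ is a symmetric association scheme with adjacency matrices $A_0=I,\ldots,A_d$ and primitive idempotents $E_0=\frac1{|X|}J,E_1,\ldots,E_d$, which is $Q$-polynomial with respect to the ordering $E_0,\ldots,E_d$. Krein parameters $q_{i,j}^k$ are defined by $E_i\circ E_j=\frac1{|X|}\sum_k q_{i,j}^kE_k$ ($\circ$ the entrywise product); $Q$-polynomiality gives $q_{i,j}^k=0$ unless $|i-j|\le k\le i+j$. For $C\subseteq X$ with characteristic vector $\chi$, the dual inner distribution is $b_i=\frac{|X|}{|C|}\chi^TE_i\chi$. For each $i$ let $S_i$ be a real $|X|\times m_i$ matrix ($m_i=\mathrm{rank}E_i$) with $E_i=\frac1{|X|}S_iS_i^T$, the $S_i$ forming together an orthogonal diagonalization of the Bose–Mesner algebra. Let $\Delta_C$ be the diagonal matrix with $\Delta_C(x,x)=1$ if $x\in C$ and $0$ otherwise. The $i$-th characteristic matrix of $C$ is $H_i=\Delta_CS_i$. -}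

module Defs where

open import Level using (Level; _⊔_) renaming (suc to lsuc)
open import Data.Nat as ℕ using (ℕ; zero; suc; ∣_-_∣; _≤?_)
open import Data.Fin using (Fin; zero; suc; toℕ; _≟_)
open import Data.Fin.Subset using (Subset; ∣_∣)
open import Data.Bool using (Bool; true; false; if_then_else_; _∧_)
open import Data.Vec using (lookup)
open import Data.Product using (Σ; ∃; ∃₂; _×_; _,_)
open import Relation.Nullary using (¬_)
open import Relation.Nullary.Decidable using (⌊_⌋; _×-dec_)
open import Relation.Binary using (Rel; IsTotalOrder)
open import Relation.Binary.PropositionalEquality using (_≡_; _≢_)
open import Algebra.Bundles using (CommutativeRing)

-- An ordered field (the intended instance is the field of real numbers;
-- the standard library has no reals).  The inverse is total; its value
-- at 0 is unconstrained.

record OrderedField (c ℓ : Level) : Set (lsuc (c ⊔ ℓ)) where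
  field
    commutativeRing : CommutativeRing c ℓ
  open CommutativeRing commutativeRing public
  infix 30 _⁻¹
  field
    _⁻¹      : Carrier → Carrier
    inverseʳ : ∀ x → ¬ (x ≈ 0#) → (x * (x ⁻¹)) ≈ 1#
    0≉1      : ¬ (0# ≈ 1#)
    _≤_      : Rel Carrier ℓ
    isTotalOrder : IsTotalOrder _≈_ _≤_
    +-monoʳ-≤ : ∀ {x y} z → x ≤ y → (x + z) ≤ (y + z)
    *-nonneg  : ∀ {x y} → 0# ≤ x → 0# ≤ y → 0# ≤ (x * y)

count : (n : ℕ) → (Fin n → Bool) → ℕ
count zero    P = 0
count (suc n) P = (if P zero then 1 else 0) ℕ.+ count n (λ z → P (suc z))

-- Symmetric d-class association scheme on X = Fin n.
-- rel x y = i  means  (x , y) ∈ R_i.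

record SymAssocScheme (n d : ℕ) : Set where
  field
    rel          : Fin n → Fin n → Fin (suc d)
    rel-zero⇒≡   : ∀ x y → rel x y ≡ zero → x ≡ y
    ≡⇒rel-zero   : ∀ x → rel x x ≡ zero
    rel-sym      : ∀ x y → rel x y ≡ rel y x
    rel-nonempty : ∀ i → ∃₂ λ x y → rel x y ≡ i
    p            : Fin (suc d) → Fin (suc d) → Fin (suc d) → ℕ
    p-spec       : ∀ i j x y →
                   count n (λ z → ⌊ rel x z ≟ i ⌋ ∧ ⌊ rel z y ≟ j ⌋) ≡ p i j (rel x y)

module _ {c ℓ : Level} (F : OrderedField c ℓ) where
  open OrderedField F using (Carrier; _≈_; _+_; _*_; 0#; 1#; _⁻¹)

  Mat : ℕ → ℕ → Set c
  Mat a b = Fin a → Fin b → Carrier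

  Σ[_] : (n : ℕ) → (Fin n → Carrier) → Carrier
  Σ[ zero  ] f = 0#
  Σ[ suc n ] f = f zero + Σ[ n ] (λ x → f (suc x))

  ι : ℕ → Carrier
  ι zero    = 0#
  ι (suc k) = 1# + ι k

  _≈ᴹ_ : ∀ {a b} → Mat a b → Mat a b → Set ℓ
  M ≈ᴹ N = ∀ x y → M x y ≈ N x y

  _·ᴹ_ : ∀ {a b e} → Mat a b → Mat b e → Mat a e
  _·ᴹ_ {b = b} M N x y = Σ[ b ] (λ z → M x z * N z y)

  _ᵀ : ∀ {a b} → Mat a b → Mat b a
  (M ᵀ) x y = M y x

  _∘ᴹ_ : ∀ {a b} → Mat a b → Mat a b → Mat a b
  (M ∘ᴹ N) x y = M x y * N x y

  _•ᴹ_ : ∀ {a b} → Carrier → Mat a b → Mat a b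
  (α •ᴹ M) x y = α * M x y

  0ᴹ : ∀ {a b} → Mat a b
  0ᴹ x y = 0#

  Iᴹ : ∀ {a} → Mat a a
  Iᴹ x y = if ⌊ x ≟ y ⌋ then 1# else 0#

  Σᴹ[_] : ∀ {a b} (m : ℕ) → (Fin m → Mat a b) → Mat a b
  Σᴹ[ m ] M x y = Σ[ m ] (λ k → M k x y)

  adj : ∀ {n d} → SymAssocScheme n d → Fin (suc d) → Mat n n
  adj 𝒮 i x y = if ⌊ SymAssocScheme.rel 𝒮 x y ≟ i ⌋ then 1# else 0#

  record PrimitiveIdempotents {n d} (𝒮 : SymAssocScheme n d)
           (E : Fin (suc d) → Mat n n) : Set (c ⊔ ℓ) where
    field
      E₀      : ∀ x y → E zero x y ≈ (ι n) ⁻¹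
      idem    : ∀ i → (E i ·ᴹ E i) ≈ᴹ E i
      orth    : ∀ i j → i ≢ j → (E i ·ᴹ E j) ≈ᴹ 0ᴹ
      nonzero : ∀ i → ¬ (E i ≈ᴹ 0ᴹ)
      sum-I   : Σᴹ[ suc d ] E ≈ᴹ Iᴹ
      inBM    : ∀ i → ∃ λ (α : Fin (suc d) → Carrier) →
                  E i ≈ᴹ Σᴹ[ suc d ] (λ k → α k •ᴹ adj 𝒮 k)

  IsKrein : ∀ {n d} → (Fin (suc d) → Mat n n) →
            (Fin (suc d) → Fin (suc d) → Fin (suc d) → Carrier) → Set ℓ
  IsKrein {n} {d} E q = ∀ i j →
    (E i ∘ᴹ E j) ≈ᴹ (((ι n) ⁻¹) •ᴹ (Σᴹ[ suc d ] (λ k → q i j k •ᴹ E k)))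

  record QPolynomial {d} (q : Fin (suc d) → Fin (suc d) → Fin (suc d) → Carrier)
           : Set ℓ where
    field
      vanish  : ∀ i j k → toℕ i ℕ.+ toℕ j ℕ.< toℕ k → q i j k ≈ 0#
      nonzero : ∀ i j k → toℕ k ≡ toℕ i ℕ.+ toℕ j → ¬ (q i j k ≈ 0#)

  -- the S_i: E_i = (1/|X|) S_i S_i^T, and (1/√|X|)[S_0 ... S_d] is an
  -- orthogonal matrix (orthogonal diagonalization of the Bose–Mesner algebra).
  record OrthogonalDiagonalization {n d} (E : Fin (suc d) → Mat n n)
           (m : Fin (suc d) → ℕ) (S : ∀ i → Mat n (m i)) : Set ℓ where
    field
      factor   : ∀ i → (ι n •ᴹ E i) ≈ᴹ (S i ·ᴹ (S i ᵀ))
      col-norm : ∀ i a b → ((S i ᵀ) ·ᴹ S i) a b ≈ (if ⌊ a ≟ b ⌋ then ι n else 0#)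
      col-orth : ∀ i j → i ≢ j → ((S i ᵀ) ·ᴹ S j) ≈ᴹ 0ᴹ

  χ : ∀ {n} → Subset n → Fin n → Carrier
  χ C x = if lookup C x then 1# else 0#

  dualInnerDist : ∀ {n d} → (Fin (suc d) → Mat n n) → Subset n → Fin (suc d) → Carrier
  dualInnerDist {n} E C k =
    (ι n * (ι ∣ C ∣) ⁻¹) * Σ[ n ] (λ x → Σ[ n ] (λ y → χ C x * E k x y * χ C y))

  charMat : ∀ {n a} → Subset n → Mat n a → Mat n a
  charMat C Sᵢ x y = χ C x * Sᵢ x y

  frob² : ∀ {a b} → Mat a b → Carrier
  frob² {a} {b} M = Σ[ a ] (λ x → Σ[ b ] (λ y → M x y * M x y))

  ΣRange : ∀ {d} → Fin (suc d) → Fin (suc d) → (Fin (suc d) → Carrier) → Carrier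
  ΣRange {d} i j f = Σ[ suc d ] (λ k →
    if ⌊ (∣ toℕ i - toℕ j ∣ ≤? toℕ k) ×-dec (toℕ k ≤? toℕ i ℕ.+ toℕ j) ⌋
    then f k else 0#)

-- Write ⟪M, N⟫ = Σ_{x,y} M_xy N_xy.  For any A, B with the same rows,
-- ‖Aᵀ B‖² = ⟪A Aᵀ, B Bᵀ⟫.  With A = Δ_C S_i, B = Δ_C S_j, S_k S_kᵀ = |X| E_k and
-- Δ_C² = Δ_C this gives ‖H_iᵀ H_j‖² = |X|² ⟪E_i ∘ E_j, χχᵀ⟫, and the Krein identity
-- turns it into |X| Σ_k q_ij^k χᵀE_kχ.  Since b_k = (|X|/|C|) χᵀE_kχ, the right-hand
-- side is the same sum restricted to the window |i-j| ≤ k ≤ i+j, so it remains to see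
-- that q_ij^k = 0 outside the window.  Above it this is Q-polynomiality; below it we use
-- that |X| Σ_{x,y} (E_i ∘ E_j ∘ E_k)_xy = q_ij^k m_k is symmetric in i, j, k, where
-- ⟪E_l, E_k⟫ = δ_lk m_k comes from the same identity: |X|² ⟪E_l, E_k⟫ = ‖S_lᵀ S_k‖².

module Submission where

open import Level using (Level)
open import Data.Bool using (true; false; if_then_else_)
open import Data.Empty using (⊥-elim)
open import Data.Fin using (Fin; zero; suc; toℕ; _≟_)
open import Data.Fin.Properties using (suc-injective; ¬Fin0)
open import Data.Fin.Subset using (Subset; ∣_∣)
open import Data.Nat as ℕ using (ℕ; zero; suc; ∣_-_∣; _≤?_)
import Data.Nat.Properties as ℕ
open import Data.Product using (_×_; _,_; proj₁)
open import Data.Sum using (_⊎_; inj₁; inj₂)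
open import Data.Vec using (_∷_; lookup)
open import Function using (_∘_)
open import Relation.Binary using (IsTotalOrder)
open import Relation.Binary.PropositionalEquality as ≡ using (_≡_; _≢_)
open import Relation.Nullary using (¬_; yes; no)
open import Relation.Nullary.Decidable using (⌊_⌋; _×-dec_)
import Algebra.Solver.CommutativeMonoid
open import Defs

InWindow : ∀ {d} → Fin (suc d) → Fin (suc d) → Fin (suc d) → Set
InWindow i j k = ∣ toℕ i - toℕ j ∣ ℕ.≤ toℕ k × toℕ k ℕ.≤ toℕ i ℕ.+ toℕ j

module FiniteSums {c ℓ : Level} (F : OrderedField c ℓ) where
  open OrderedField F hiding (zero; -_; _-_)
  open import Algebra.Properties.Semiring.Sum semiring
    using (sum; sum-cong-≋; sum-cong-≗; sum-replicate-zero; *-distribˡ-sum; *-distribʳ-sum; ∑-comm)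
  open import Relation.Binary.Reasoning.Setoid setoid

  private
    Σ = Σ[_] F

  Σ≡sum : ∀ {n} (f : Fin n → Carrier) → Σ n f ≡ sum f
  Σ≡sum {zero}  f = ≡.refl
  Σ≡sum {suc n} f = ≡.cong (f zero +_) (Σ≡sum (λ x → f (suc x)))

  ΣΣ≡sumsum : ∀ {m n} (f : Fin m → Fin n → Carrier) →
              Σ m (λ x → Σ n (f x)) ≡ sum (λ x → sum (f x))
  ΣΣ≡sumsum {m} {n} f =
    ≡.trans (Σ≡sum (λ x → Σ n (f x))) (sum-cong-≗ {m} (λ x → Σ≡sum (f x)))

  Σ-cong : ∀ {n} {f g : Fin n → Carrier} → (∀ x → f x ≈ g x) → Σ n f ≈ Σ n g
  Σ-cong {n} {f} {g} f≈g = begin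
    Σ n f  ≡⟨ Σ≡sum f ⟩
    sum f  ≈⟨ sum-cong-≋ f≈g ⟩
    sum g  ≡⟨ Σ≡sum g ⟨
    Σ n g  ∎

  Σ-zero : ∀ {n} {f : Fin n → Carrier} → (∀ x → f x ≈ 0#) → Σ n f ≈ 0#
  Σ-zero {n} f≈0 =
    trans (Σ-cong f≈0) (trans (reflexive (Σ≡sum {n} (λ _ → 0#))) (sum-replicate-zero n))

  Σ-*ˡ : ∀ {n} a (f : Fin n → Carrier) → a * Σ n f ≈ Σ n (λ x → a * f x)
  Σ-*ˡ a f = begin
    a * Σ _ f                 ≡⟨ ≡.cong (a *_) (Σ≡sum f) ⟩
    a * sum f                 ≈⟨ *-distribˡ-sum a f ⟩
    sum (λ x → a * f x)       ≡⟨ Σ≡sum (λ x → a * f x) ⟨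
    Σ _ (λ x → a * f x)       ∎

  Σ-*ʳ : ∀ {n} a (f : Fin n → Carrier) → Σ n f * a ≈ Σ n (λ x → f x * a)
  Σ-*ʳ a f = begin
    Σ _ f * a                 ≡⟨ ≡.cong (_* a) (Σ≡sum f) ⟩
    sum f * a                 ≈⟨ *-distribʳ-sum a f ⟩
    sum (λ x → f x * a)       ≡⟨ Σ≡sum (λ x → f x * a) ⟨
    Σ _ (λ x → f x * a)       ∎

  Σ-comm : ∀ {m n} (f : Fin m → Fin n → Carrier) →
           Σ m (λ x → Σ n (f x)) ≈ Σ n (λ y → Σ m (λ x → f x y))
  Σ-comm f = begin
    Σ _ (λ x → Σ _ (f x))              ≡⟨ ΣΣ≡sumsum f ⟩
    sum (λ x → sum (f x))              ≈⟨ ∑-comm f ⟩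
    sum (λ y → sum (λ x → f x y))      ≡⟨ ΣΣ≡sumsum (λ y x → f x y) ⟨
    Σ _ (λ y → Σ _ (λ x → f x y))      ∎

  Σ-single : ∀ {n} {f : Fin n → Carrier} (k : Fin n) →
             (∀ l → l ≢ k → f l ≈ 0#) → Σ n f ≈ f k
  Σ-single {suc n} zero    off = trans (+-congˡ (Σ-zero (λ x → off (suc x) λ ()))) (+-identityʳ _)
  Σ-single {suc n} {f} (suc k) off =
    trans (+-congʳ (off zero λ ())) (trans (+-identityˡ _)
      (Σ-single {f = λ x → f (suc x)} k (λ l l≢k → off (suc l) (l≢k ∘ suc-injective))))

  Σ-const : ∀ n a → Σ n (λ _ → a) ≈ ι F n * a
  Σ-const zero    a = sym (zeroˡ a)
  Σ-const (suc n) a = begin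
    a + Σ n (λ _ → a)      ≈⟨ +-cong (sym (*-identityˡ a)) (Σ-const n a) ⟩
    1# * a + ι F n * a     ≈⟨ distribʳ a 1# (ι F n) ⟨
    ι F (suc n) * a        ∎

  ΣΣ-cong : ∀ {a b} {f g : Fin a → Fin b → Carrier} → (∀ x y → f x y ≈ g x y) →
            Σ a (λ x → Σ b (f x)) ≈ Σ a (λ x → Σ b (g x))
  ΣΣ-cong f≈g = Σ-cong (λ x → Σ-cong (f≈g x))

  ΣΣ-*ˡ : ∀ {a b} α (f : Fin a → Fin b → Carrier) →
          α * Σ a (λ x → Σ b (f x)) ≈ Σ a (λ x → Σ b (λ y → α * f x y))
  ΣΣ-*ˡ {b = b} α f = trans (Σ-*ˡ α (λ x → Σ b (f x))) (Σ-cong (λ x → Σ-*ˡ α (f x)))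

  Σ-*-Σ : ∀ {a b} (f : Fin a → Carrier) (g : Fin b → Carrier) →
          Σ a f * Σ b g ≈ Σ a (λ x → Σ b (λ y → f x * g y))
  Σ-*-Σ f g = trans (Σ-*ʳ _ f) (Σ-cong (λ x → Σ-*ˡ (f x) g))

  ΣΣ-comm-Σ : ∀ {a b e} (f : Fin a → Fin b → Fin e → Carrier) →
              Σ a (λ x → Σ b (λ y → Σ e (f x y))) ≈ Σ e (λ l → Σ a (λ x → Σ b (λ y → f x y l)))
  ΣΣ-comm-Σ {b = b} f = trans (Σ-cong (λ x → Σ-comm (f x))) (Σ-comm (λ x l → Σ b (λ y → f x y l)))

  ΣΣ-comm-ΣΣ : ∀ {a b e g} (f : Fin a → Fin b → Fin e → Fin g → Carrier) →
               Σ a (λ x → Σ b (λ y → Σ e (λ u → Σ g (f x y u)))) ≈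
               Σ e (λ u → Σ g (λ v → Σ a (λ x → Σ b (λ y → f x y u v))))
  ΣΣ-comm-ΣΣ {g = g} f = trans (ΣΣ-comm-Σ (λ x y u → Σ g (f x y u)))
                       (Σ-cong (λ u → ΣΣ-comm-Σ (λ x y v → f x y u v)))

  ΣRange-full : ∀ {d} (i j : Fin (suc d)) (f : Fin (suc d) → Carrier) →
                (∀ k → ¬ InWindow i j k → f k ≈ 0#) →
                ΣRange F i j f ≈ Σ (suc d) f
  ΣRange-full i j f outside≈0 = Σ-cong inRange
    where
      inRange : ∀ k → (if ⌊ (∣ toℕ i - toℕ j ∣ ≤? toℕ k) ×-dec (toℕ k ≤? toℕ i ℕ.+ toℕ j) ⌋
                       then f k else 0#) ≈ f k
      inRange k with (∣ toℕ i - toℕ j ∣ ≤? toℕ k) ×-dec (toℕ k ≤? toℕ i ℕ.+ toℕ j)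
      ... | yes _       = refl
      ... | no outside = sym (outside≈0 k outside)

module OrderedFieldFacts {c ℓ : Level} (F : OrderedField c ℓ) where
  open OrderedField F hiding (zero)
  open import Algebra.Properties.Ring ring using (-‿distribˡ-*; -‿distribʳ-*)
  open import Algebra.Properties.AbelianGroup +-abelianGroup using (⁻¹-involutive)
  open import Relation.Binary.Reasoning.Setoid setoid
  module ≤ = IsTotalOrder isTotalOrder

  cancelˡ : ∀ {a u v} → ¬ (a ≈ 0#) → a * u ≈ a * v → u ≈ v
  cancelˡ {a} {u} {v} a≉0 au≈av = begin
    u                   ≈⟨ *-identityˡ u ⟨
    1# * u              ≈⟨ *-congʳ a⁻¹a≈1 ⟨
    (a ⁻¹ * a) * u      ≈⟨ *-assoc _ _ _ ⟩
    a ⁻¹ * (a * u)      ≈⟨ *-congˡ au≈av ⟩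
    a ⁻¹ * (a * v)      ≈⟨ *-assoc _ _ _ ⟨
    (a ⁻¹ * a) * v      ≈⟨ *-congʳ a⁻¹a≈1 ⟩
    1# * v              ≈⟨ *-identityˡ v ⟩
    v                   ∎
    where a⁻¹a≈1 = trans (*-comm (a ⁻¹) a) (inverseʳ a a≉0)

  zero-product : ∀ {a u} → ¬ (a ≈ 0#) → a * u ≈ 0# → u ≈ 0#
  zero-product a≉0 au≈0 = cancelˡ a≉0 (trans au≈0 (sym (zeroʳ _)))

  -- Squares are nonnegative: if x ≤ 0 then 0 ≤ -x and x * x = (-x) * (-x).
  0≤x*x : ∀ x → 0# ≤ (x * x)
  0≤x*x x with ≤.total 0# x
  ... | inj₁ 0≤x = *-nonneg 0≤x 0≤x
  ... | inj₂ x≤0 = ≤.trans (*-nonneg 0≤-x 0≤-x) (≤.reflexive -x*-x≈x*x)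
    where
      0≤-x : 0# ≤ (- x)
      0≤-x = ≤.trans (≤.reflexive (sym (-‿inverseʳ x)))
               (≤.trans (+-monoʳ-≤ (- x) x≤0) (≤.reflexive (+-identityˡ (- x))))
      -x*-x≈x*x : - x * - x ≈ x * x
      -x*-x≈x*x = begin
        - x * - x        ≈⟨ -‿distribˡ-* x (- x) ⟨
        - (x * - x)      ≈⟨ -‿cong (-‿distribʳ-* x x) ⟨
        - - (x * x)      ≈⟨ ⁻¹-involutive (x * x) ⟩
        x * x            ∎

  0≤1 : 0# ≤ 1#
  0≤1 = ≤.trans (0≤x*x 1#) (≤.reflexive (*-identityˡ 1#))

  -- An ordered field has characteristic zero: 1 ≤ 1 + 1 + ... + 1.
  0≤ι : ∀ k → 0# ≤ ι F k
  1≤ι-suc : ∀ k → 1# ≤ ι F (suc k)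

  0≤ι zero    = ≤.refl
  0≤ι (suc k) = ≤.trans 0≤1 (1≤ι-suc k)

  1≤ι-suc k = ≤.trans (≤.reflexive (sym (+-identityˡ 1#)))
                      (≤.trans (+-monoʳ-≤ 1# (0≤ι k)) (≤.reflexive (+-comm (ι F k) 1#)))

  ι≉0 : ∀ {k} → k ≢ 0 → ¬ (ι F k ≈ 0#)
  ι≉0 {zero}  k≢0 _   = k≢0 ≡.refl
  ι≉0 {suc k} _   ι≈0 = 0≉1 (≤.antisym 0≤1 (≤.trans (1≤ι-suc k) (≤.reflexive ι≈0)))

  -- ι k * (ι k)⁻¹ is 1 unless k = 0, in which case the hypothesis kills a.
  ι-inverse-cancel : ∀ k {a} → (k ≡ 0 → a ≈ 0#) → ι F k * ((ι F k) ⁻¹ * a) ≈ a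
  ι-inverse-cancel zero    a≈0 = trans (zeroˡ _) (sym (a≈0 ≡.refl))
  ι-inverse-cancel (suc k) {a} _ = begin
    ι F (suc k) * ((ι F (suc k)) ⁻¹ * a)  ≈⟨ *-assoc _ _ _ ⟨
    (ι F (suc k) * (ι F (suc k)) ⁻¹) * a  ≈⟨ *-congʳ (inverseʳ _ (ι≉0 {suc k} λ ())) ⟩
    1# * a                                ≈⟨ *-identityˡ a ⟩
    a                                     ∎

module FrobeniusInner {c ℓ : Level} (F : OrderedField c ℓ) where
  open OrderedField F hiding (zero)
  open FiniteSums F
  open import Algebra.Properties.CommutativeSemigroup *-commutativeSemigroup
    using (interchange)
  open import Relation.Binary.Reasoning.Setoid setoid

  private
    Σ = Σ[_] F

  ⟪_,_⟫ : ∀ {a b} → Mat F a b → Mat F a b → Carrier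
  ⟪_,_⟫ {a} {b} M N = Σ a (λ x → Σ b (λ y → M x y * N x y))

  gram : ∀ {a b} → Mat F a b → Mat F a a
  gram A = _·ᴹ_ F A (_ᵀ F A)

  ⟪⟫-scaleˡ : ∀ {a b} α (M N : Mat F a b) → ⟪ _•ᴹ_ F α M , N ⟫ ≈ α * ⟪ M , N ⟫
  ⟪⟫-scaleˡ α M N = trans (ΣΣ-cong (λ x y → *-assoc α (M x y) (N x y)))
                          (sym (ΣΣ-*ˡ α (λ x y → M x y * N x y)))

  ⟪⟫-linearˡ : ∀ {a b e} (β : Fin e → Carrier) (M : Fin e → Mat F a b) (N : Mat F a b) →
               ⟪ Σᴹ[_] F e (λ l → _•ᴹ_ F (β l) (M l)) , N ⟫ ≈ Σ e (λ l → β l * ⟪ M l , N ⟫)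
  ⟪⟫-linearˡ {a} {b} {e} β M N = begin
    Σ a (λ x → Σ b (λ y → Σ e (λ l → β l * M l x y) * N x y))
      ≈⟨ ΣΣ-cong (λ x y → Σ-*ʳ (N x y) (λ l → β l * M l x y)) ⟩
    Σ a (λ x → Σ b (λ y → Σ e (λ l → (β l * M l x y) * N x y)))
      ≈⟨ ΣΣ-comm-Σ (λ x y l → (β l * M l x y) * N x y) ⟩
    Σ e (λ l → Σ a (λ x → Σ b (λ y → (β l * M l x y) * N x y)))
      ≈⟨ Σ-cong (λ l → ⟪⟫-scaleˡ (β l) (M l) N) ⟩
    Σ e (λ l → β l * ⟪ M l , N ⟫)
      ∎

  frob²-transpose-product : ∀ {a b e} (A : Mat F a b) (B : Mat F a e) →
    frob² F (_·ᴹ_ F (_ᵀ F A) B) ≈ ⟪ gram A , gram B ⟫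
  frob²-transpose-product {a} {b} {e} A B = begin
    Σ b (λ u → Σ e (λ v → Σ a (λ x → A x u * B x v) * Σ a (λ y → A y u * B y v)))
      ≈⟨ ΣΣ-cong (λ u v → Σ-*-Σ (λ x → A x u * B x v) (λ y → A y u * B y v)) ⟩
    Σ b (λ u → Σ e (λ v → Σ a (λ x → Σ a (λ y → (A x u * B x v) * (A y u * B y v)))))
      ≈⟨ ΣΣ-comm-ΣΣ (λ u v x y → (A x u * B x v) * (A y u * B y v)) ⟩
    Σ a (λ x → Σ a (λ y → Σ b (λ u → Σ e (λ v → (A x u * B x v) * (A y u * B y v)))))
      ≈⟨ ΣΣ-cong (λ x y → ΣΣ-cong (λ u v → interchange (A x u) (B x v) (A y u) (B y v))) ⟩
    Σ a (λ x → Σ a (λ y → Σ b (λ u → Σ e (λ v → (A x u * A y u) * (B x v * B y v)))))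
      ≈⟨ ΣΣ-cong (λ x y → Σ-*-Σ (λ u → A x u * A y u) (λ v → B x v * B y v)) ⟨
    ⟪ gram A , gram B ⟫
      ∎

  χ-idem : ∀ {a} (C : Subset a) x → χ F C x * χ F C x ≈ χ F C x
  χ-idem C x with lookup C x
  ... | true  = *-identityˡ 1#
  ... | false = zeroˡ 0#

  χ-empty : ∀ {a} (C : Subset a) → ∣ C ∣ ≡ 0 → ∀ x → χ F C x ≈ 0#
  χ-empty (false ∷ C) ∣C∣≡0 zero    = refl
  χ-empty (false ∷ C) ∣C∣≡0 (suc x) = χ-empty C ∣C∣≡0 x

  -- The rank-one 0/1 matrix χ_C χ_Cᵀ; pairing with it computes χ_Cᵀ M χ_C.
  mask : ∀ {a} → Subset a → Mat F a a
  mask C x y = χ F C x * χ F C y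

  mask-idem : ∀ {a} (C : Subset a) x y → mask C x y * mask C x y ≈ mask C x y
  mask-idem C x y = trans (interchange (χ F C x) (χ F C y) (χ F C x) (χ F C y))
                          (*-cong (χ-idem C x) (χ-idem C y))

  -- For C = ∅ the mask vanishes (needed because b_k divides by |C|).
  ⟪⟫-mask-empty : ∀ {a} (C : Subset a) (M : Mat F a a) → ∣ C ∣ ≡ 0 → ⟪ M , mask C ⟫ ≈ 0#
  ⟪⟫-mask-empty {a} C M ∣C∣≡0 = Σ-zero {a} λ x → Σ-zero {a} λ y →
    trans (*-congˡ (*-congʳ (χ-empty C ∣C∣≡0 x))) (trans (*-congˡ (zeroˡ (χ F C y))) (zeroʳ (M x y)))

  gram-charMat : ∀ {a b} (C : Subset a) (A : Mat F a b) x y →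
                 gram (charMat F C A) x y ≈ mask C x y * gram A x y
  gram-charMat {b = b} C A x y = begin
    Σ b (λ u → (χ F C x * A x u) * (χ F C y * A y u))
      ≈⟨ Σ-cong (λ u → interchange (χ F C x) (A x u) (χ F C y) (A y u)) ⟩
    Σ b (λ u → mask C x y * (A x u * A y u))
      ≈⟨ Σ-*ˡ (mask C x y) (λ u → A x u * A y u) ⟨
    mask C x y * gram A x y
      ∎

<∣-∣⇒separated : ∀ a b k → k ℕ.< ∣ a - b ∣ → a ℕ.+ k ℕ.< b ⊎ b ℕ.+ k ℕ.< a
<∣-∣⇒separated zero    b       k k<b   = inj₁ k<b
<∣-∣⇒separated (suc a) zero    k k<a+1 = inj₂ k<a+1
<∣-∣⇒separated (suc a) (suc b) k k<∣a-b∣ with <∣-∣⇒separated a b k k<∣a-b∣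
... | inj₁ a+k<b = inj₁ (ℕ.s≤s a+k<b)
... | inj₂ b+k<a = inj₂ (ℕ.s≤s b+k<a)

module QPolynomialScheme {c ℓ : Level} (F : OrderedField c ℓ) {n d : ℕ}
  (𝒮 : SymAssocScheme n d)
  (E : Fin (suc d) → Mat F n n) (idempotents : PrimitiveIdempotents F 𝒮 E)
  (q : Fin (suc d) → Fin (suc d) → Fin (suc d) → OrderedField.Carrier F)
  (krein : IsKrein F E q) (qPoly : QPolynomial F q)
  (m : Fin (suc d) → ℕ) (S : ∀ i → Mat F n (m i))
  (diag : OrthogonalDiagonalization F E m S) where

  open OrderedField F hiding (zero; -_; _-_)
  open FiniteSums F
  open OrderedFieldFacts F
  open FrobeniusInner F
  open PrimitiveIdempotents idempotents using (nonzero)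
  open QPolynomial qPoly using (vanish)
  open OrthogonalDiagonalization diag using (factor; col-norm; col-orth)
  open import Algebra.Properties.CommutativeSemigroup *-commutativeSemigroup
    using (interchange; xy∙z≈xz∙y; xy∙z≈zy∙x; xy∙z≈y∙xz)
  module CM = Algebra.Solver.CommutativeMonoid *-commutativeMonoid
  open CM using (_⊕_; _⊜_)
  open import Relation.Binary.Reasoning.Setoid setoid

  private
    Σ = Σ[_] F
    _ᵗ = _ᵀ F
    _·_ = _·ᴹ_ F

  -- N = |X|, which is nonzero (hence invertible) because the scheme relations are nonempty.
  N : Carrier
  N = ι F n

  n≢0 : n ≢ 0
  n≢0 n≡0 = ¬Fin0 (≡.subst Fin n≡0 (proj₁ (SymAssocScheme.rel-nonempty 𝒮 zero)))

  N≉0 : ¬ (N ≈ 0#)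
  N≉0 = ι≉0 n≢0

  N-cancel : ∀ a → N * (N ⁻¹ * a) ≈ a
  N-cancel a = ι-inverse-cancel n (⊥-elim ∘ n≢0)

  N*N≉0 : ¬ (N * N ≈ 0#)
  N*N≉0 N*N≈0 = N≉0 (zero-product N≉0 N*N≈0)

  gram-S : ∀ k x y → gram (S k) x y ≈ N * E k x y
  gram-S k x y = sym (factor k x y)

  -- A vanishing rank would force E_k = 0.
  rank≢0 : ∀ k → m k ≢ 0
  rank≢0 k mk≡0 = nonzero k λ x y →
    zero-product N≉0 (trans (factor k x y) (Σ-zero λ u → ⊥-elim (¬Fin0 (≡.subst Fin mk≡0 u))))

  ⟪E,E⟫-via-S : ∀ l k → (N * N) * ⟪ E l , E k ⟫ ≈ frob² F ((S l ᵗ) · S k)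
  ⟪E,E⟫-via-S l k = begin
    (N * N) * ⟪ E l , E k ⟫
      ≈⟨ ΣΣ-*ˡ (N * N) (λ x y → E l x y * E k x y) ⟩
    Σ n (λ x → Σ n (λ y → (N * N) * (E l x y * E k x y)))
      ≈⟨ ΣΣ-cong (λ x y → trans (interchange N N (E l x y) (E k x y))
                               (sym (*-cong (gram-S l x y) (gram-S k x y)))) ⟩
    ⟪ gram (S l) , gram (S k) ⟫
      ≈⟨ frob²-transpose-product (S l) (S k) ⟨
    frob² F ((S l ᵗ) · S k)
      ∎

  ⟪E,E⟫-orth : ∀ l k → l ≢ k → ⟪ E l , E k ⟫ ≈ 0#
  ⟪E,E⟫-orth l k l≢k = zero-product N*N≉0 (trans (⟪E,E⟫-via-S l k)
    (Σ-zero λ a → Σ-zero λ b → trans (*-cong (col-orth l k l≢k a b) (col-orth l k l≢k a b)) (zeroˡ 0#)))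

  -- ... and ⟪E_k, E_k⟫ = m_k, since the m_k columns of S_k are orthogonal of norm² |X|.
  ⟪E,E⟫-self : ∀ k → ⟪ E k , E k ⟫ ≈ ι F (m k)
  ⟪E,E⟫-self k = cancelˡ N*N≉0 (begin
    (N * N) * ⟪ E k , E k ⟫
      ≈⟨ ⟪E,E⟫-via-S k k ⟩
    frob² F ((S k ᵗ) · S k)
      ≈⟨ ΣΣ-cong (λ a b → *-cong (col-norm k a b) (col-norm k a b)) ⟩
    Σ (m k) (λ a → Σ (m k) (λ b → δ a b * δ a b))
      ≈⟨ Σ-cong (λ a → Σ-single a (δ²-off a)) ⟩
    Σ (m k) (λ a → δ a a * δ a a)
      ≈⟨ Σ-cong (λ a → *-cong (δ-diag a) (δ-diag a)) ⟩
    Σ (m k) (λ _ → N * N)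
      ≈⟨ Σ-const (m k) (N * N) ⟩
    ι F (m k) * (N * N)
      ≈⟨ *-comm _ _ ⟩
    (N * N) * ι F (m k)
      ∎)
    where
      δ : Fin (m k) → Fin (m k) → Carrier
      δ a b = if ⌊ a ≟ b ⌋ then N else 0#
      δ-diag : ∀ a → δ a a ≈ N
      δ-diag a with a ≟ a
      ... | yes _   = refl
      ... | no a≢a = ⊥-elim (a≢a ≡.refl)
      δ²-off : ∀ a b → b ≢ a → δ a b * δ a b ≈ 0#
      δ²-off a b b≢a with a ≟ b
      ... | yes a≡b = ⊥-elim (b≢a (≡.sym a≡b))
      ... | no _    = zeroˡ 0#

  krein-pairing : ∀ i j (M : Mat F n n) →
                  ⟪ _∘ᴹ_ F (E i) (E j) , M ⟫ ≈ N ⁻¹ * Σ (suc d) (λ k → q i j k * ⟪ E k , M ⟫)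
  krein-pairing i j M = begin
    ⟪ _∘ᴹ_ F (E i) (E j) , M ⟫
      ≈⟨ ΣΣ-cong (λ x y → *-congʳ (krein i j x y)) ⟩
    ⟪ _•ᴹ_ F (N ⁻¹) (Σᴹ[_] F (suc d) (λ k → _•ᴹ_ F (q i j k) (E k))) , M ⟫
      ≈⟨ ⟪⟫-scaleˡ (N ⁻¹) _ M ⟩
    N ⁻¹ * ⟪ Σᴹ[_] F (suc d) (λ k → _•ᴹ_ F (q i j k) (E k)) , M ⟫
      ≈⟨ *-congˡ (⟪⟫-linearˡ (q i j) E M) ⟩
    N ⁻¹ * Σ (suc d) (λ k → q i j k * ⟪ E k , M ⟫)
      ∎

  triple : Fin (suc d) → Fin (suc d) → Fin (suc d) → Carrier
  triple i j k = ⟪ _∘ᴹ_ F (E i) (E j) , E k ⟫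

  triple-swapʳ : ∀ i j k → triple i j k ≈ triple i k j
  triple-swapʳ i j k = ΣΣ-cong (λ x y → xy∙z≈xz∙y (E i x y) (E j x y) (E k x y))

  triple-swap-outer : ∀ i j k → triple i j k ≈ triple k j i
  triple-swap-outer i j k = ΣΣ-cong (λ x y → xy∙z≈zy∙x (E i x y) (E j x y) (E k x y))

  triple-krein : ∀ i j k → N * triple i j k ≈ q i j k * ι F (m k)
  triple-krein i j k = begin
    N * triple i j k
      ≈⟨ *-congˡ (krein-pairing i j (E k)) ⟩
    N * (N ⁻¹ * Σ (suc d) (λ l → q i j l * ⟪ E l , E k ⟫))
      ≈⟨ N-cancel _ ⟩
    Σ (suc d) (λ l → q i j l * ⟪ E l , E k ⟫)
      ≈⟨ Σ-single k (λ l l≢k → trans (*-congˡ (⟪E,E⟫-orth l k l≢k)) (zeroʳ (q i j l))) ⟩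
    q i j k * ⟪ E k , E k ⟫
      ≈⟨ *-congˡ (⟪E,E⟫-self k) ⟩
    q i j k * ι F (m k)
      ∎

  triple≈0⇒q≈0 : ∀ i j k → triple i j k ≈ 0# → q i j k ≈ 0#
  triple≈0⇒q≈0 i j k t≈0 = zero-product (ι≉0 (rank≢0 k))
    (trans (*-comm _ _) (trans (sym (triple-krein i j k)) (trans (*-congˡ t≈0) (zeroʳ N))))

  q≈0⇒triple≈0 : ∀ i j k → q i j k ≈ 0# → triple i j k ≈ 0#
  q≈0⇒triple≈0 i j k q≈0 = zero-product N≉0
    (trans (triple-krein i j k) (trans (*-congʳ q≈0) (zeroˡ _)))

  -- Lower end of the window: by the symmetry of the triple sums, q_ij^k = 0 for
  -- k < |i - j| follows from the upper bound for q_ik^j or q_kj^i.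
  krein-lower : ∀ i j k → toℕ k ℕ.< ∣ toℕ i - toℕ j ∣ → q i j k ≈ 0#
  krein-lower i j k k<∣i-j∣ with <∣-∣⇒separated (toℕ i) (toℕ j) (toℕ k) k<∣i-j∣
  ... | inj₁ i+k<j = triple≈0⇒q≈0 i j k
        (trans (triple-swapʳ i j k) (q≈0⇒triple≈0 i k j (vanish i k j i+k<j)))
  ... | inj₂ j+k<i = triple≈0⇒q≈0 i j k
        (trans (triple-swap-outer i j k) (q≈0⇒triple≈0 k j i
          (vanish k j i (≡.subst (ℕ._< toℕ i) (ℕ.+-comm (toℕ j) (toℕ k)) j+k<i))))

  krein-window : ∀ i j k → ¬ InWindow i j k → q i j k ≈ 0#
  krein-window i j k outside with toℕ k ≤? toℕ i ℕ.+ toℕ j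
  ... | no  k≰i+j = vanish i j k (ℕ.≰⇒> k≰i+j)
  ... | yes k≤i+j = krein-lower i j k (ℕ.≰⇒> λ lower → outside (lower , k≤i+j))

  gram-H-product : ∀ C i j x y →
    gram (charMat F C (S i)) x y * gram (charMat F C (S j)) x y ≈
    ((N * N) * (E i x y * E j x y)) * mask C x y
  gram-H-product C i j x y = begin
    gram (charMat F C (S i)) x y * gram (charMat F C (S j)) x y
      ≈⟨ *-cong (gram-charMat C (S i) x y) (gram-charMat C (S j) x y) ⟩
    (mask C x y * gram (S i) x y) * (mask C x y * gram (S j) x y)
      ≈⟨ interchange (mask C x y) (gram (S i) x y) (mask C x y) (gram (S j) x y) ⟩
    (mask C x y * mask C x y) * (gram (S i) x y * gram (S j) x y)
      ≈⟨ *-cong (mask-idem C x y) (*-cong (gram-S i x y) (gram-S j x y)) ⟩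
    mask C x y * ((N * E i x y) * (N * E j x y))
      ≈⟨ *-congˡ (interchange N N (E i x y) (E j x y)) ⟨
    mask C x y * ((N * N) * (E i x y * E j x y))
      ≈⟨ *-comm _ _ ⟩
    ((N * N) * (E i x y * E j x y)) * mask C x y
      ∎

  norm-expansion : ∀ C i j →
    frob² F ((charMat F C (S i) ᵗ) · charMat F C (S j)) ≈
    N * Σ (suc d) (λ k → q i j k * ⟪ E k , mask C ⟫)
  norm-expansion C i j = begin
    frob² F ((charMat F C (S i) ᵗ) · charMat F C (S j))
      ≈⟨ frob²-transpose-product (charMat F C (S i)) (charMat F C (S j)) ⟩
    ⟪ gram (charMat F C (S i)) , gram (charMat F C (S j)) ⟫
      ≈⟨ ΣΣ-cong (gram-H-product C i j) ⟩
    ⟪ _•ᴹ_ F (N * N) (_∘ᴹ_ F (E i) (E j)) , mask C ⟫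
      ≈⟨ ⟪⟫-scaleˡ (N * N) (_∘ᴹ_ F (E i) (E j)) (mask C) ⟩
    (N * N) * ⟪ _∘ᴹ_ F (E i) (E j) , mask C ⟫
      ≈⟨ *-congˡ (krein-pairing i j (mask C)) ⟩
    (N * N) * (N ⁻¹ * Σ (suc d) (λ k → q i j k * ⟪ E k , mask C ⟫))
      ≈⟨ trans (*-assoc N N _) (*-congˡ (N-cancel _)) ⟩
    N * Σ (suc d) (λ k → q i j k * ⟪ E k , mask C ⟫)
      ∎

  dualInnerDist-mask : ∀ C k → dualInnerDist F E C k ≈ (N * (ι F ∣ C ∣) ⁻¹) * ⟪ E k , mask C ⟫
  dualInnerDist-mask C k = *-congˡ (ΣΣ-cong λ x y → xy∙z≈y∙xz (χ F C x) (E k x y) (χ F C y))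

  window-expansion : ∀ C i j →
    ι F ∣ C ∣ * ΣRange F i j (λ k → q i j k * dualInnerDist F E C k) ≈
    N * Σ (suc d) (λ k → q i j k * ⟪ E k , mask C ⟫)
  window-expansion C i j = begin
    card * ΣRange F i j (λ k → q i j k * dualInnerDist F E C k)
      ≈⟨ *-congˡ (ΣRange-full i j _ λ k outside →
           trans (*-congʳ (krein-window i j k outside)) (zeroˡ (dualInnerDist F E C k))) ⟩
    card * Σ (suc d) (λ k → q i j k * dualInnerDist F E C k)
      ≈⟨ Σ-*ˡ card (λ k → q i j k * dualInnerDist F E C k) ⟩
    Σ (suc d) (λ k → card * (q i j k * dualInnerDist F E C k))
      ≈⟨ Σ-cong term ⟩
    Σ (suc d) (λ k → N * (q i j k * ⟪ E k , mask C ⟫))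
      ≈⟨ Σ-*ˡ N (λ k → q i j k * ⟪ E k , mask C ⟫) ⟨
    N * Σ (suc d) (λ k → q i j k * ⟪ E k , mask C ⟫)
      ∎
    where
      card = ι F ∣ C ∣
      term : ∀ k → card * (q i j k * dualInnerDist F E C k) ≈ N * (q i j k * ⟪ E k , mask C ⟫)
      term k = begin
        card * (q i j k * dualInnerDist F E C k)
          ≈⟨ *-congˡ (*-congˡ (dualInnerDist-mask C k)) ⟩
        card * (q i j k * ((N * card ⁻¹) * P))
          ≈⟨ CM.solve 5 (λ c′ q′ N′ c⁻¹ P′ → c′ ⊕ (q′ ⊕ ((N′ ⊕ c⁻¹) ⊕ P′))
                                          ⊜ N′ ⊕ (q′ ⊕ (c′ ⊕ (c⁻¹ ⊕ P′))))
                      refl card (q i j k) N (card ⁻¹) P ⟩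
        N * (q i j k * (card * (card ⁻¹ * P)))
          ≈⟨ *-congˡ (*-congˡ (ι-inverse-cancel ∣ C ∣ (⟪⟫-mask-empty C (E k)))) ⟩
        N * (q i j k * P)
          ∎
        where P = ⟪ E k , mask C ⟫

lemma3p2 : ∀ {c ℓ} (F : OrderedField c ℓ) {n d : ℕ}
    (𝒮 : SymAssocScheme n d)
    (E : Fin (suc d) → Mat F n n) → PrimitiveIdempotents F 𝒮 E →
    (q : Fin (suc d) → Fin (suc d) → Fin (suc d) → OrderedField.Carrier F) →
    IsKrein F E q → QPolynomial F q →
    (m : Fin (suc d) → ℕ) (S : ∀ i → Mat F n (m i)) →
    OrthogonalDiagonalization F E m S →
    (C : Subset n) (i j : Fin (suc d)) →
    OrderedField._≈_ F
      (frob² F (_·ᴹ_ F (_ᵀ F (charMat F C (S i))) (charMat F C (S j))))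
      (OrderedField._*_ F (ι F ∣ C ∣)
        (ΣRange F i j (λ k → OrderedField._*_ F (q i j k) (dualInnerDist F E C k))))
lemma3p2 F 𝒮 E idempotents q krein qPoly m S diag C i j =
  trans (norm-expansion C i j) (sym (window-expansion C i j))
  where
    open OrderedField F using (trans; sym)
    open QPolynomialScheme F 𝒮 E idempotents q krein qPoly m S diag
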